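{- Let $\sigma$ be the morphism on $\{0,1,2\}^*$ defined by $\sigma(0)=01$, $\sigma(1)=12$, $\sigma(2)=20$, and let $\mathbf{t}=\sigma^{\infty}(0)$ be its fixed point starting with $0$. For factors $u,v$ of $\mathbf{t}$ of length $3$, write $\sigma^6(u)=u_0u_1\cdots u_{191}$ and $\sigma^6(v)=v_0v_1\cdots v_{191}$. For $64\leq i,j<128$ with $u_i=0$ and $v_j=2$, define for $0<m<192-\max\{i,j\}$ and $0<p\leq\min\{i,j\}$ \[R(u,v,i,j,m)=\sum_{\ell=0}^{m}(v_{j+\ell}-u_{i+\ell}),\qquad L(u,v,i,j,-p)=\sum_{\ell=1}^{p}(u_{i-\ell}-v_{j-\ell}).\] Then for all such $u,v,i,j$, either $R(u,v,i,j,m)=1$ for some $0<m<192-\max\{i,j\}$, or $L(u,v,i,j,-p)=1$ for some $0<p\leq\min\{i,j\}$.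
   Context: Letters $0,1,2$ are viewed as integers; $\sigma^6$ is the sixth iterate of $\sigma$, so $\sigma^6$ of a length-3 word has length $192$. -}

module Defs where

open import Data.Nat using (ℕ; zero; suc; _∸_)
import Data.Nat as ℕ
open import Data.Fin using (Fin; zero; suc)
open import Data.List using (List; []; _∷_; _++_; concatMap; map; foldr; upTo)
open import Data.Integer using (ℤ; +_; _-_; _+_)
import Data.Integer as ℤ
open import Data.Product using (∃; _,_)
open import Relation.Binary.PropositionalEquality using (_≡_)

Letter : Set
Letter = Fin 3

val : Letter → ℤ
val x = + (Data.Fin.toℕ x)

σ₁ : Letter → List Letter
σ₁ zero = zero ∷ suc zero ∷ []
σ₁ (suc zero) = suc zero ∷ suc (suc zero) ∷ []
σ₁ (suc (suc zero)) = suc (suc zero) ∷ zero ∷ []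

σ : List Letter → List Letter
σ = concatMap σ₁

σ^ : ℕ → List Letter → List Letter
σ^ zero w = w
σ^ (suc k) w = σ (σ^ k w)

-- letter at position n of a word (0-indexed); default 0 if out of range
-- (only ever used with in-range positions below)
at : List Letter → ℕ → Letter
at [] _ = zero
at (x ∷ w) zero = x
at (x ∷ w) (suc n) = at w n

-- the fixed point t = σ^∞(0): its n-th letter is the n-th letter of
-- σ^(n+1)(0), a word of length 2^(n+1) > n which is a prefix of t.
t : ℕ → Letter
t n = at (σ^ (suc n) (zero ∷ [])) n

Factor3 : List Letter → Set
Factor3 u = ∃ λ n → u ≡ t n ∷ t (n ℕ.+ 1) ∷ t (n ℕ.+ 2) ∷ []

sumℤ : List ℤ → ℤ
sumℤ = foldr _+_ (+ 0)

R : List Letter → List Letter → ℕ → ℕ → ℕ → ℤ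
R u v i j m = sumℤ (map (λ ℓ → val (at (σ^ 6 v) (j ℕ.+ ℓ)) - val (at (σ^ 6 u) (i ℕ.+ ℓ))) (upTo (suc m)))

L : List Letter → List Letter → ℕ → ℕ → ℕ → ℤ
L u v i j p = sumℤ (map (λ k → val (at (σ^ 6 u) (i ∸ suc k)) - val (at (σ^ 6 v) (j ∸ suc k))) (upTo p))

-- For u = abc and v = def, σ⁶(u) = σ⁶(a)σ⁶(b)σ⁶(c) is a concatenation of three blocks of
-- length 64, and the positions 64 ≤ i, j < 128 lie in the middle block. The proof is a finite
-- verification. The right sums only read the last two blocks, so for each of the 81 choices of
-- (b, c, e, f) and each admissible pair (i, j) we search, incrementally along the two words,
-- for m > 0 with R = 1. In the few cases where there is none, some left sum L(−p) with p ≤ 6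
-- equals 1, whatever the first letters a and d are.
module Submission where

open import Defs
open import Data.Nat using (ℕ; zero; suc; _≤_; _<_; _+_; _∸_; _⊔_; _⊓_; z≤n; s≤s; _<?_; _≤?_)
open import Data.Nat.Properties
  using (module ≤-Reasoning; +-assoc; +-comm; +-suc; +-distribˡ-⊔; +-cancelˡ-<; +-monoʳ-<;
         <⇒≤; <⇒≱; m<1+n⇒m<n∨m≡n; m∸n≢0⇒n<m; m≤o∸n⇒m+n≤o; m≤n⇒∃[o]m+o≡n)
open import Data.Fin using (Fin; zero; suc)
open import Data.Fin.Properties using (_≟_)
open import Data.List using (List; []; _∷_; _++_; map; upTo; drop; length; allFin)
open import Data.List.Properties using (concatMap-++; map-cong; map-applyUpTo; map-upTo)
import Data.List.Relation.Unary.All as All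
open import Data.List.Relation.Unary.All.Properties using (all⁺)
import Data.List.Relation.Unary.Any as Any
open import Data.List.Membership.Propositional.Properties using (∈-allFin)
open import Data.Bool using (Bool; true; T; not; _∧_; _∨_)
open import Data.Bool.ListAction using (all)
open import Data.Bool.Properties using (T-∧; T-≡)
open import Data.Integer using (ℤ; +_; _-_) renaming (_+_ to _+ℤ_)
import Data.Integer.Properties as ℤ
open import Data.Maybe using (Maybe; just; nothing; is-just; to-witness-T; _<∣>_)
import Data.Maybe as Maybe
open import Data.Product using (∃; _×_; _,_)
open import Data.Sum using (_⊎_; inj₁; inj₂)
import Data.Sum as Sum
open import Data.Empty using (⊥-elim)
open import Function using (_∘_; Equivalence)
open import Relation.Nullary using (Dec; yes; no; does)
open import Relation.Nullary.Decidable using (_×-dec_; dec⇒maybe)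
open import Relation.Binary.PropositionalEquality
  using (_≡_; refl; sym; trans; cong; cong₂; subst; subst₂; module ≡-Reasoning)

pattern one = suc zero
pattern two = suc (suc zero)

σ^-++ : ∀ k xs ys → σ^ k (xs ++ ys) ≡ σ^ k xs ++ σ^ k ys
σ^-++ zero    xs ys = refl
σ^-++ (suc k) xs ys = trans (cong σ (σ^-++ k xs ys)) (concatMap-++ σ₁ (σ^ k xs) (σ^ k ys))

at-drop : ∀ i (U : List Letter) ℓ → at U (i + ℓ) ≡ at (drop i U) ℓ
at-drop zero    U       ℓ = refl
at-drop (suc i) []      ℓ = refl
at-drop (suc i) (x ∷ U) ℓ = at-drop i U ℓ

at-++ : ∀ (A U : List Letter) {k} n → length A ≡ k → at (A ++ U) (k + n) ≡ at U n
at-++ []      U n refl = refl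
at-++ (x ∷ A) U n refl = at-++ A U n refl

sumℤ-upTo-suc : ∀ (f : ℕ → ℤ) n →
  sumℤ (map f (upTo (suc n))) ≡ f 0 +ℤ sumℤ (map (f ∘ suc) (upTo n))
sumℤ-upTo-suc f n = cong (λ xs → f 0 +ℤ sumℤ xs)
  (trans (map-applyUpTo suc f n) (sym (map-upTo (f ∘ suc) n)))

-- σ⁶(a) written out, so that the verification below does not recompute it.
block : Letter → List Letter
block zero =
  zero ∷ one ∷ one ∷ two ∷ one ∷ two ∷ two ∷ zero ∷ one ∷ two ∷ two ∷ zero ∷ two ∷ zero ∷ zero ∷ one ∷
  one ∷ two ∷ two ∷ zero ∷ two ∷ zero ∷ zero ∷ one ∷ two ∷ zero ∷ zero ∷ one ∷ zero ∷ one ∷ one ∷ two ∷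
  one ∷ two ∷ two ∷ zero ∷ two ∷ zero ∷ zero ∷ one ∷ two ∷ zero ∷ zero ∷ one ∷ zero ∷ one ∷ one ∷ two ∷
  two ∷ zero ∷ zero ∷ one ∷ zero ∷ one ∷ one ∷ two ∷ zero ∷ one ∷ one ∷ two ∷ one ∷ two ∷ two ∷ zero ∷ []
block one =
  one ∷ two ∷ two ∷ zero ∷ two ∷ zero ∷ zero ∷ one ∷ two ∷ zero ∷ zero ∷ one ∷ zero ∷ one ∷ one ∷ two ∷
  two ∷ zero ∷ zero ∷ one ∷ zero ∷ one ∷ one ∷ two ∷ zero ∷ one ∷ one ∷ two ∷ one ∷ two ∷ two ∷ zero ∷
  two ∷ zero ∷ zero ∷ one ∷ zero ∷ one ∷ one ∷ two ∷ zero ∷ one ∷ one ∷ two ∷ one ∷ two ∷ two ∷ zero ∷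
  zero ∷ one ∷ one ∷ two ∷ one ∷ two ∷ two ∷ zero ∷ one ∷ two ∷ two ∷ zero ∷ two ∷ zero ∷ zero ∷ one ∷ []
block two =
  two ∷ zero ∷ zero ∷ one ∷ zero ∷ one ∷ one ∷ two ∷ zero ∷ one ∷ one ∷ two ∷ one ∷ two ∷ two ∷ zero ∷
  zero ∷ one ∷ one ∷ two ∷ one ∷ two ∷ two ∷ zero ∷ one ∷ two ∷ two ∷ zero ∷ two ∷ zero ∷ zero ∷ one ∷
  zero ∷ one ∷ one ∷ two ∷ one ∷ two ∷ two ∷ zero ∷ one ∷ two ∷ two ∷ zero ∷ two ∷ zero ∷ zero ∷ one ∷
  one ∷ two ∷ two ∷ zero ∷ two ∷ zero ∷ zero ∷ one ∷ two ∷ zero ∷ zero ∷ one ∷ zero ∷ one ∷ one ∷ two ∷ []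

σ⁶-block : ∀ a → σ^ 6 (a ∷ []) ≡ block a
σ⁶-block zero = refl
σ⁶-block one  = refl
σ⁶-block two  = refl

length-block : ∀ a → length (block a) ≡ 64
length-block zero = refl
length-block one  = refl
length-block two  = refl

σ⁶-∷∷∷ : ∀ a b c → σ^ 6 (a ∷ b ∷ c ∷ []) ≡ block a ++ block b ++ block c
σ⁶-∷∷∷ a b c = begin
  σ^ 6 (a ∷ b ∷ c ∷ [])
    ≡⟨ σ^-++ 6 (a ∷ []) (b ∷ c ∷ []) ⟩
  σ^ 6 (a ∷ []) ++ σ^ 6 (b ∷ c ∷ [])
    ≡⟨ cong (σ^ 6 (a ∷ []) ++_) (σ^-++ 6 (b ∷ []) (c ∷ [])) ⟩
  σ^ 6 (a ∷ []) ++ σ^ 6 (b ∷ []) ++ σ^ 6 (c ∷ [])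
    ≡⟨ cong₂ _++_ (σ⁶-block a) (cong₂ _++_ (σ⁶-block b) (σ⁶-block c)) ⟩
  block a ++ block b ++ block c ∎
  where open ≡-Reasoning

rightSum : (U V : List Letter) (i j m : ℕ) → ℤ
rightSum U V i j m = sumℤ (map (λ ℓ → val (at V (j + ℓ)) - val (at U (i + ℓ))) (upTo (suc m)))

leftSum : (U V : List Letter) (i j p : ℕ) → ℤ
leftSum U V i j p = sumℤ (map (λ k → val (at U (i ∸ suc k)) - val (at V (j ∸ suc k))) (upTo p))

RightHit : (N : ℕ) (U V : List Letter) (i j : ℕ) → Set
RightHit N U V i j = ∃ λ m → 0 < m × m + (i ⊔ j) < N × rightSum U V i j m ≡ + 1

LeftHit : (U V : List Letter) (i j : ℕ) → Set
LeftHit U V i j = ∃ λ p → 0 < p × p ≤ i ⊓ j × leftSum U V i j p ≡ + 1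

Hits : (U V : List Letter) (i j : ℕ) → Set
Hits U V i j = RightHit 192 U V i j ⊎ LeftHit U V i j

headDiff : (X Y : List Letter) → ℤ
headDiff X Y = val (at Y 0) - val (at X 0)

diffSum : (X Y : List Letter) → ℕ → ℤ
diffSum X Y zero    = + 0
diffSum X Y (suc n) = headDiff X Y +ℤ diffSum (drop 1 X) (drop 1 Y) n

sum≡diffSum : ∀ X Y n → sumℤ (map (λ ℓ → val (at Y ℓ) - val (at X ℓ)) (upTo n)) ≡ diffSum X Y n
sum≡diffSum X Y zero    = refl
sum≡diffSum X Y (suc n) = begin
  sumℤ (map (λ ℓ → val (at Y ℓ) - val (at X ℓ)) (upTo (suc n)))
    ≡⟨ sumℤ-upTo-suc (λ ℓ → val (at Y ℓ) - val (at X ℓ)) n ⟩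
  headDiff X Y +ℤ sumℤ (map (λ ℓ → val (at Y (suc ℓ)) - val (at X (suc ℓ))) (upTo n))
    ≡⟨ cong (λ xs → headDiff X Y +ℤ sumℤ xs)
            (map-cong (λ ℓ → cong₂ (λ y x → val y - val x) (at-drop 1 Y ℓ) (at-drop 1 X ℓ)) (upTo n)) ⟩
  headDiff X Y +ℤ sumℤ (map (λ ℓ → val (at (drop 1 Y) ℓ) - val (at (drop 1 X) ℓ)) (upTo n))
    ≡⟨ cong (headDiff X Y +ℤ_) (sum≡diffSum (drop 1 X) (drop 1 Y) n) ⟩
  diffSum X Y (suc n) ∎
  where open ≡-Reasoning

rightSum≡diffSum : ∀ U V i j m → rightSum U V i j m ≡ diffSum (drop i U) (drop j V) (suc m)
rightSum≡diffSum U V i j m =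
  trans (cong sumℤ (map-cong (λ ℓ → cong₂ (λ y x → val y - val x) (at-drop j V ℓ) (at-drop i U ℓ))
                             (upTo (suc m))))
        (sum≡diffSum (drop i U) (drop j V) (suc m))

rightSum-++ : ∀ {k} (A B U V : List Letter) i j m → length A ≡ k → length B ≡ k →
  rightSum (A ++ U) (B ++ V) (k + i) (k + j) m ≡ rightSum U V i j m
rightSum-++ {k} A B U V i j m |A|≡k |B|≡k = cong sumℤ (map-cong
  (λ ℓ → cong₂ (λ y x → val y - val x) (shift B V j ℓ |B|≡k) (shift A U i ℓ |A|≡k))
  (upTo (suc m)))
  where
  shift : ∀ W Z n ℓ → length W ≡ k → at (W ++ Z) (k + n + ℓ) ≡ at Z (n + ℓ)
  shift W Z n ℓ |W|≡k = trans (cong (at (W ++ Z)) (+-assoc k n ℓ)) (at-++ W Z (n + ℓ) |W|≡k)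

RightHit-++ : ∀ {N k} (A B U V : List Letter) i j → length A ≡ k → length B ≡ k →
  RightHit N U V i j → RightHit (k + N) (A ++ U) (B ++ V) (k + i) (k + j)
RightHit-++ {N} {k} A B U V i j |A|≡k |B|≡k (m , 0<m , bound , hit) =
  m , 0<m , shifted , trans (rightSum-++ A B U V i j m |A|≡k |B|≡k) hit
  where
  open ≤-Reasoning
  shifted : m + ((k + i) ⊔ (k + j)) < k + N
  shifted = begin-strict
    m + ((k + i) ⊔ (k + j)) ≡⟨ cong (λ n → m + n) (sym (+-distribˡ-⊔ k i j)) ⟩
    m + (k + (i ⊔ j))       ≡⟨ sym (+-assoc m k (i ⊔ j)) ⟩
    m + k + (i ⊔ j)         ≡⟨ cong (λ n → n + (i ⊔ j)) (+-comm m k) ⟩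
    k + m + (i ⊔ j)         ≡⟨ +-assoc k m (i ⊔ j) ⟩
    k + (m + (i ⊔ j))       <⟨ +-monoʳ-< k bound ⟩
    k + N                   ∎

diffSumHit? : (c : ℤ) (X Y : List Letter) (k : ℕ) →
              Maybe (∃ λ n → 0 < n × n ≤ k × c +ℤ diffSum X Y n ≡ + 1)
diffSumHit? c X Y zero = nothing
diffSumHit? c X Y (suc k) with c +ℤ headDiff X Y ℤ.≟ + 1
... | yes hit = just (1 , s≤s z≤n , s≤s z≤n , trans (cong (c +ℤ_) (ℤ.+-identityʳ (headDiff X Y))) hit)
... | no _    = Maybe.map later (diffSumHit? (c +ℤ headDiff X Y) (drop 1 X) (drop 1 Y) k)
  where
  later : ∃ (λ n → 0 < n × n ≤ k × c +ℤ headDiff X Y +ℤ diffSum (drop 1 X) (drop 1 Y) n ≡ + 1) →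
          ∃ (λ n → 0 < n × n ≤ suc k × c +ℤ diffSum X Y n ≡ + 1)
  later (n , _ , n≤k , hit) = suc n , s≤s z≤n , s≤s n≤k , trans (sym (ℤ.+-assoc c _ _)) hit

0<m≤n∸suc[o]⇒m+o<n : ∀ {m n o} → 0 < m → m ≤ n ∸ suc o → m + o < n
0<m≤n∸suc[o]⇒m+o<n {m} {n} {o} 0<m m≤ = subst (_≤ n) (+-suc m o) (m≤o∸n⇒m+n≤o m {suc o} (<⇒≤ 1+o<n) m≤)
  where
  1+o<n : suc o < n
  1+o<n = m∸n≢0⇒n<m {n} {suc o} (λ n∸1+o≡0 → <⇒≱ 0<m (subst (m ≤_) n∸1+o≡0 m≤))

rightHit? : ∀ N U V i j → Maybe (RightHit N U V i j)
rightHit? N U V i j =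
  Maybe.map found (diffSumHit? (headDiff X Y) (drop 1 X) (drop 1 Y) (N ∸ suc (i ⊔ j)))
  where
  X Y : List Letter
  X = drop i U
  Y = drop j V
  found : ∃ (λ m → 0 < m × m ≤ N ∸ suc (i ⊔ j) × headDiff X Y +ℤ diffSum (drop 1 X) (drop 1 Y) m ≡ + 1) →
          RightHit N U V i j
  found (m , 0<m , m≤ , hit) =
    m , 0<m , 0<m≤n∸suc[o]⇒m+o<n 0<m m≤ , trans (rightSum≡diffSum U V i j m) hit

leftHit? : ∀ (U V : List Letter) i j → Maybe (LeftHit U V i j)
leftHit? U V i j = Maybe.map Any.satisfied (dec⇒maybe (Any.any? hit? (upTo 7)))
  where
  hit? : ∀ p → Dec (0 < p × p ≤ i ⊓ j × leftSum U V i j p ≡ + 1)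
  hit? p = 0 <? p ×-dec p ≤? i ⊓ j ×-dec leftSum U V i j p ℤ.≟ + 1

all-just : ∀ {n p} {P : Fin n → Set p} → (∀ x → Maybe (P x)) → Maybe (∀ x → P x)
all-just {zero}  f = just λ ()
all-just {suc n} f with f zero | all-just (f ∘ suc)
... | just p | just ps = just λ { zero → p ; (suc x) → ps x }
... | _      | _       = nothing

LeftHits : (b c e f : Letter) (i j : ℕ) → Set
LeftHits b c e f i j =
  ∀ a d → LeftHit (block a ++ block b ++ block c) (block d ++ block e ++ block f) (64 + i) (64 + j)

hit? : ∀ b c e f i j →
       Maybe (RightHit 128 (block b ++ block c) (block e ++ block f) i j ⊎ LeftHits b c e f i j)
hit? b c e f i j =
  Maybe.map inj₁ (rightHit? 128 (block b ++ block c) (block e ++ block f) i j)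
  <∣> Maybe.map inj₂ (all-just λ a → all-just λ d →
        leftHit? (block a ++ block b ++ block c) (block d ++ block e ++ block f) (64 + i) (64 + j))

all< : ℕ → (ℕ → Bool) → Bool
all< zero    p = true
all< (suc n) p = p n ∧ all< n p

all<-sound : ∀ n (p : ℕ → Bool) → T (all< n p) → ∀ {k} → k < n → T (p k)
all<-sound (suc n) p ok k<1+n with Equivalence.to T-∧ ok | m<1+n⇒m<n∨m≡n k<1+n
... | _   , rest | inj₁ k<n  = all<-sound n p rest k<n
... | pn  , _    | inj₂ refl = pn

-- Quantifying over this list rather than allFin 3 keeps the element type syntactically Letter,
-- so that checking blocksCheck≡true below does not re-run the verification during conversion.
letters : List Letter
letters = allFin 3

all-letters : (p : Letter → Bool) → all p letters ≡ true → ∀ a → p a ≡ true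
all-letters p ok a =
  Equivalence.to T-≡ (All.lookup (all⁺ p letters (Equivalence.from T-≡ ok)) (∈-allFin a))

implies-sound : ∀ {P : Set} (d : Dec P) {b} → T (not (does d) ∨ b) → P → T b
implies-sound (yes _) ok _ = ok
implies-sound (no ¬p) _  p = ⊥-elim (¬p p)

cellCheck : (b c e f : Letter) (i j : ℕ) → Bool
cellCheck b c e f i j = not (does (at (block e ++ block f) j ≟ two)) ∨ is-just (hit? b c e f i j)

rowCheck : (b c e f : Letter) (i : ℕ) → Bool
rowCheck b c e f i = not (does (at (block b ++ block c) i ≟ zero)) ∨ all< 64 (cellCheck b c e f i)

blocksCheck : (b c e f : Letter) → Bool
blocksCheck b c e f = all< 64 (rowCheck b c e f)

blocksCheck-sound : ∀ b c e f → blocksCheck b c e f ≡ true → ∀ {i j} → i < 64 → j < 64 →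
  at (block b ++ block c) i ≡ zero → at (block e ++ block f) j ≡ two → T (is-just (hit? b c e f i j))
blocksCheck-sound b c e f ok {i} {j} i<64 j<64 uᵢ≡0 vⱼ≡2 =
  implies-sound (at (block e ++ block f) j ≟ two) (all<-sound 64 (cellCheck b c e f i) row j<64) vⱼ≡2
  where
  row : T (all< 64 (cellCheck b c e f i))
  row = implies-sound (at (block b ++ block c) i ≟ zero)
          (all<-sound 64 (rowCheck b c e f) (Equivalence.from T-≡ ok) i<64) uᵢ≡0

-- Stated with ≡ true rather than as T (…): Agda checks the refl below much faster.
blocksCheck-everywhere :
  all (λ b → all (λ c → all (λ e → all (blocksCheck b c e) letters) letters) letters) letters ≡ true
blocksCheck-everywhere = refl

blocksCheck≡true : ∀ b c e f → blocksCheck b c e f ≡ true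
blocksCheck≡true b c e f =
  all-letters (blocksCheck b c e) (all-letters (λ e → all (blocksCheck b c e) letters)
    (all-letters (λ c → all (λ e → all (blocksCheck b c e) letters) letters)
      (all-letters (λ b → all (λ c → all (λ e → all (blocksCheck b c e) letters) letters) letters)
        blocksCheck-everywhere b) c) e) f

hits-middle : ∀ a b c d e f {i j} → i < 64 → j < 64 →
  at (σ^ 6 (a ∷ b ∷ c ∷ [])) (64 + i) ≡ zero → at (σ^ 6 (d ∷ e ∷ f ∷ [])) (64 + j) ≡ two →
  Hits (σ^ 6 (a ∷ b ∷ c ∷ [])) (σ^ 6 (d ∷ e ∷ f ∷ [])) (64 + i) (64 + j)
hits-middle a b c d e f {i} {j} i<64 j<64 uᵢ≡0 vⱼ≡2 =
  subst₂ (λ U V → Hits U V (64 + i) (64 + j)) (sym (σ⁶-∷∷∷ a b c)) (sym (σ⁶-∷∷∷ d e f))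
    (Sum.map extend (λ left → left a d) (to-witness-T (hit? b c e f i j) found))
  where
  W W′ : List Letter
  W  = block b ++ block c
  W′ = block e ++ block f
  middle : ∀ x y z n {l} → at (σ^ 6 (x ∷ y ∷ z ∷ [])) (64 + n) ≡ l → at (block y ++ block z) n ≡ l
  middle x y z n eq = trans (sym (at-++ (block x) (block y ++ block z) {64} n (length-block x)))
                            (subst (λ U → at U (64 + n) ≡ _) (σ⁶-∷∷∷ x y z) eq)
  found : T (is-just (hit? b c e f i j))
  found = blocksCheck-sound b c e f (blocksCheck≡true b c e f) i<64 j<64
            (middle a b c i uᵢ≡0) (middle d e f j vⱼ≡2)
  extend : RightHit 128 W W′ i j → RightHit 192 (block a ++ W) (block d ++ W′) (64 + i) (64 + j)
  extend = RightHit-++ {k = 64} (block a) (block d) W W′ i j (length-block a) (length-block d)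

hits : ∀ a b c d e f {i j} → 64 ≤ i → i < 128 → 64 ≤ j → j < 128 →
  at (σ^ 6 (a ∷ b ∷ c ∷ [])) i ≡ zero → at (σ^ 6 (d ∷ e ∷ f ∷ [])) j ≡ two →
  Hits (σ^ 6 (a ∷ b ∷ c ∷ [])) (σ^ 6 (d ∷ e ∷ f ∷ [])) i j
hits a b c d e f 64≤i i<128 64≤j j<128 = split (m≤n⇒∃[o]m+o≡n 64≤i) (m≤n⇒∃[o]m+o≡n 64≤j) i<128 j<128
  where
  -- Matching on the decompositions i = 64 + i′, j = 64 + j′ through with-abstraction instead
  -- is very slow to check.
  split : ∀ {i j} → (∃ λ i′ → 64 + i′ ≡ i) → (∃ λ j′ → 64 + j′ ≡ j) → i < 128 → j < 128 →
    at (σ^ 6 (a ∷ b ∷ c ∷ [])) i ≡ zero → at (σ^ 6 (d ∷ e ∷ f ∷ [])) j ≡ two →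
    Hits (σ^ 6 (a ∷ b ∷ c ∷ [])) (σ^ 6 (d ∷ e ∷ f ∷ [])) i j
  split (i′ , refl) (j′ , refl) i<128 j<128 =
    hits-middle a b c d e f (+-cancelˡ-< 64 i′ 64 i<128) (+-cancelˡ-< 64 j′ 64 j<128)

lemma8 : (u v : List Letter) → Factor3 u → Factor3 v →
    (i j : ℕ) → 64 ≤ i → i < 128 → 64 ≤ j → j < 128 →
    at (σ^ 6 u) i ≡ zero → at (σ^ 6 v) j ≡ suc (suc zero) →
    (∃ λ m → (0 < m) × (m + (i ⊔ j) < 192) × (R u v i j m ≡ + 1))
    ⊎ (∃ λ p → (0 < p) × (p ≤ i ⊓ j) × (L u v i j p ≡ + 1))
lemma8 _ _ (n , refl) (n′ , refl) i j =
  hits (t n) (t (n + 1)) (t (n + 2)) (t n′) (t (n′ + 1)) (t (n′ + 2))
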